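{- Let $P$ be a finite poset of height $n+1$ that is homogeneous and descending. For every $k \ge 2$, every $i \in \{1,\dots,n\}$, every integer $s$ with $1 \le s \le i$, and every $J \subseteq \{i+1,\dots,n\}$, \[ c_k'(i, J) \le c_k'(i - s, J - s), \] where $J - s = \{j - s : j \in J\}$. Moreover, if $P$ is strictly descending and $|J| \ge k-1$, then this inequality is strict.
   Context: Let $(P,\preceq)$ be a finite poset. A chain is a set of pairwise comparable elements; a $k$-chain is a chain with $k$ elements; the height is the maximum number of elements of a chain. $P$ is homogeneous if for any two maximal chains $L, L'$ there is an automorphism of $P$ mapping $L$ onto $L'$. The rank $r(x)$ is the length of the longest chain of elements strictly below $x$, and $r(S)=\{r(x):x\in S\}$. For a chain $L$ and $J\subseteq\mathbb{N}$, $c_k'(L,J)$ is the number of $k$-chains $M$ with $L\subseteq M$ and $r(M\setminus L)\subseteq J$; for homogeneous $P$ it depends only on $r(L)$, and $c_k'(i,J)$ denotes $c_k'(\{x\},J)$ for any $x$ of rank $i$ (similarly $c_2'(i,j) = c_2'(i,\{j\})$). $P$ is descending if $c_2'(i,j) \le c_2'(i-1,j-1)$ for all $0<i<j\le n$, and strictly descending if all these inequalities are strict. -}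

module Defs where

open import Data.Nat using (ℕ; zero; suc; _⊔_; _≡ᵇ_; _∸_; _≤_; _<_)
open import Data.Bool using (Bool; true; false; T; _∧_; _∨_; not; if_then_else_)
open import Data.Fin using (Fin; _≟_)
open import Data.Fin.Subset using (Subset; ∣_∣; ⁅_⁆)
open import Data.Vec using (Vec; []; _∷_; lookup)
open import Data.List using (List; []; _∷_; [_]; map; _++_; foldr; filter; length; allFin)
open import Data.Bool.ListAction using (all; any)
open import Data.Product using (_×_; Σ)
open import Data.Fin.Permutation using (Permutation; _⟨$⟩ʳ_)
open import Relation.Binary.PropositionalEquality using (_≡_)
open import Relation.Nullary.Decidable using (⌊_⌋)
open import Relation.Unary using (Pred)
open import Data.Bool.Properties using (T?)

record FinPoset : Set where
  field
    size    : ℕ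
    le      : Fin size → Fin size → Bool
    refl    : ∀ x → T (le x x)
    antisym : ∀ x y → T (le x y) → T (le y x) → x ≡ y
    trans   : ∀ x y z → T (le x y) → T (le y z) → T (le x z)

module _ (P : FinPoset) where
  open FinPoset P

  Elt : Set
  Elt = Fin size

  allSubsets : (m : ℕ) → List (Subset m)
  allSubsets zero = [ [] ]
  allSubsets (suc m) = map (false ∷_) (allSubsets m) ++ map (true ∷_) (allSubsets m)

  mem : Subset size → Elt → Bool
  mem S x = lookup S x

  isChainB : Subset size → Bool
  isChainB S = all (λ x → all (λ y → not (mem S x ∧ mem S y) ∨ (le x y ∨ le y x)) (allFin size)) (allFin size)

  IsChain : Subset size → Set
  IsChain S = T (isChainB S)

  chains : List (Subset size)
  chains = filter (λ S → T? (isChainB S)) (allSubsets size)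

  maxList : List ℕ → ℕ
  maxList = foldr _⊔_ 0

  ltB : Elt → Elt → Bool
  ltB x y = le x y ∧ not ⌊ x ≟ y ⌋

  belowB : Elt → Subset size → Bool
  belowB x S = all (λ y → not (mem S y) ∨ ltB y x) (allFin size)

  rank : Elt → ℕ
  rank x = maxList (map ∣_∣ (filter (λ S → T? (belowB x S)) chains))

  height : ℕ
  height = maxList (map ∣_∣ chains)

  subsetB : Subset size → Subset size → Bool
  subsetB L M = all (λ y → not (mem L y) ∨ mem M y) (allFin size)

  inJ : List ℕ → ℕ → Bool
  inJ J r = any (λ j → r ≡ᵇ j) J

  countedB : ℕ → Subset size → List ℕ → Subset size → Bool
  countedB k L J M =
    isChainB M ∧ (∣ M ∣ ≡ᵇ k) ∧ subsetB L M
      ∧ all (λ y → not (mem M y ∧ not (mem L y)) ∨ inJ J (rank y)) (allFin size)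

  c′ : ℕ → Subset size → List ℕ → ℕ
  c′ k L J = length (filter (λ M → T? (countedB k L J M)) (allSubsets size))

  IsMaximalChain : Subset size → Set
  IsMaximalChain L = IsChain L × (∀ M → IsChain M → T (subsetB L M) → T (subsetB M L))

  IsAutomorphism : Permutation size size → Set
  IsAutomorphism σ = ∀ x y → le x y ≡ le (σ ⟨$⟩ʳ x) (σ ⟨$⟩ʳ y)

  MapsOnto : Permutation size size → Subset size → Subset size → Set
  MapsOnto σ L L' = ∀ x → mem L x ≡ mem L' (σ ⟨$⟩ʳ x)

  Homogeneous : Set
  Homogeneous = ∀ L L' → IsMaximalChain L → IsMaximalChain L' →
    Σ (Permutation size size) (λ σ → IsAutomorphism σ × MapsOnto σ L L')

  Descending : Set
  Descending = ∀ i j → 0 < i → i < j → suc j ≤ height → ∀ x y → rank x ≡ i → rank y ≡ i ∸ 1 →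
    c′ 2 ⁅ x ⁆ [ j ] ≤ c′ 2 ⁅ y ⁆ [ j ∸ 1 ]

  StrictlyDescending : Set
  StrictlyDescending = ∀ i j → 0 < i → i < j → suc j ≤ height → ∀ x y → rank x ≡ i → rank y ≡ i ∸ 1 →
    c′ 2 ⁅ x ⁆ [ j ] < c′ 2 ⁅ y ⁆ [ j ∸ 1 ]

-- Induction on J, sorted increasingly so that its least element j is the head. A k-chain counted by
-- c′ₖ(x, J) either avoids rank j, and is then counted by c′ₖ(x, J ∖ {j}), or meets rank j in a single
-- element z > x, and removing x leaves a (k−1)-chain counted by c′ₖ₋₁(z, J ∖ {j}). Hence
--   c′ₖ(x, J) = c′ₖ(x, J ∖ {j}) + Σ_{z > x, r(z) = j} c′ₖ₋₁(z, J ∖ {j}),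
-- and the same with y, j − s and J − s in place of x, j and J. The first terms compare by induction.
-- The sums have c′₂(x, {j}) and c′₂(y, {j − s}) terms, which compare by applying the descending
-- inequality s times along elements of the intermediate ranks, and their terms compare pairwise by
-- induction, as r(z) = j and r(w) = j − s. Under strict descent the number of terms grows strictly,
-- and each term on the y side is positive, again by induction.
module Submission where

open import Defs
open import Data.Nat using (ℕ; suc; _≤_; _<_; _∸_)
open import Data.List using (List; map; length)
open import Data.List.Relation.Unary.All using (All)
open import Data.List.Relation.Unary.Unique.Propositional using (Unique)
open import Data.Product using (_×_)
open import Data.Fin.Subset using (⁅_⁆)
open import Relation.Binary.PropositionalEquality using (_≡_)

open import Data.Nat.Properties hiding (_≟_)
open import Algebra.Properties.CommutativeSemigroup +-commutativeSemigroup using (interchange)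
open import Relation.Binary.PropositionalEquality
  using (refl; sym; trans; cong; cong₂; subst; subst₂; _≢_; ≢-sym; resp₂; setoid; module ≡-Reasoning)
open import Data.Bool using (Bool; true; false; T; _∧_; _∨_; not; if_then_else_)
open import Data.Bool.ListAction using (all; and)
open import Data.Bool.Properties using (T?; T-∧; T-∨; T-≡; T-not-≡)
open import Data.Fin using (Fin; zero; suc; _≟_)
open import Data.Fin.Subset using (Subset; ∣_∣) renaming (⊥ to ∅)
open import Data.Fin.Subset.Properties using (x∈⁅x⁆; x∈⁅y⁆⇒x≡y; ∣⊥∣≡0; ∣⁅x⁆∣≡1)
open import Data.List using ([]; _∷_; [_]; _++_; foldr; filter; allFin)
open import Data.List.Extrema ≤-totalOrder using (argmax; argmax-all; f[xs]≤f[argmax])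
open import Data.List.Membership.Propositional using (_∈_; find; lose)
open import Data.List.Membership.Propositional.Properties
  using (∈-allFin; ∈-filter⁺; ∈-filter⁻; ∈-map⁺; ∈-map⁻; ∈-++⁺ˡ; ∈-++⁺ʳ; foldr-selective)
open import Data.List.Properties using (map-++; map-∘; map-cong)
open import Data.List.Relation.Binary.Permutation.Propositional using (_↭_; ↭-sym; ↭⇒↭ₛ)
open import Data.List.Relation.Binary.Permutation.Propositional.Properties
  using (∈-resp-↭; ↭-length; All-resp-↭)
open import Data.List.Relation.Binary.Permutation.Setoid.Properties (setoid ℕ) using (AllPairs-resp-↭)
open import Data.List.Relation.Unary.All using ([]; _∷_)
import Data.List.Relation.Unary.All as All
open import Data.List.Relation.Unary.All.Properties using (all⁺; all⁻)
open import Data.List.Relation.Unary.AllPairs using (AllPairs; []; _∷_)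
import Data.List.Relation.Unary.AllPairs as AllPairs
open import Data.List.Relation.Unary.Any using (here; there; any?)
import Data.List.Relation.Unary.Any as Any
open import Data.List.Relation.Unary.Any.Properties using (any⁺; any⁻)
import Data.List.Relation.Unary.Unique.Propositional.Properties as Unique
open import Data.List.Relation.Unary.Sorted.TotalOrder.Properties using (Sorted⇒AllPairs)
open import Data.List.Sort ≤-decTotalOrder using (sort; sort-↭; sort-↗)
open import Data.Nat using (zero; _+_; _⊔_; _≡ᵇ_; z≤n; s≤s; z<s)
open import Data.Nat.ListAction using (sum)
open import Data.Nat.ListAction.Properties using (sum-++)
open import Data.Product using (∃-syntax; _,_; proj₁; proj₂; uncurry)
open import Data.Sum using (_⊎_; inj₁; inj₂; swap; fromInj₂)
open import Data.Vec using ([]; _∷_; lookup; _[_]≔_)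
open import Data.Vec.Properties
  using ([]=⇒lookup; lookup⇒[]=; ∷-injectiveˡ; ∷-injectiveʳ; lookup∘update; lookup∘update′; lookup-replicate)
open import Function using (_∘_; case_of_; _⇔_; mk⇔; Equivalence)
open import Function.Properties.Equivalence using () renaming (sym to ⇔-sym; trans to ⇔-trans)
open import Relation.Nullary using (¬_; yes; no; contradiction)

open Equivalence using (to; from)

indicator : Bool → ℕ
indicator true  = 1
indicator false = 0

indicator-T : ∀ {b} → T b → indicator b ≡ 1
indicator-T {true} _ = refl

indicator-¬T : ∀ {b} → ¬ T b → indicator b ≡ 0
indicator-¬T {false} _  = refl
indicator-¬T {true}  ¬t = contradiction _ ¬t

¬T⇒≡false : ∀ {b} → ¬ T b → b ≡ false
¬T⇒≡false {false} _  = refl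
¬T⇒≡false {true}  ¬t = contradiction _ ¬t

T-injective : ∀ {a b} → T a ⇔ T b → a ≡ b
T-injective {false} {false} _   = refl
T-injective {false} {true}  a⇔b = contradiction _ (from a⇔b)
T-injective {true}  {false} a⇔b = contradiction _ (to a⇔b)
T-injective {true}  {true}  _   = refl

T-→ : ∀ {a b} → T (not a ∨ b) ⇔ (T a → T b)
T-→ {true}  = mk⇔ (λ t _ → t) (λ f → f _)
T-→ {false} = mk⇔ (λ _ ()) (λ _ → _)

T-all-allFin : ∀ {n} (p : Fin n → Bool) → T (all p (allFin n)) ⇔ (∀ x → T (p x))
T-all-allFin {n} p = mk⇔ (λ t x → All.lookup (all⁺ p (allFin n) t) (∈-allFin x))
                         (λ h → all⁻ p (All.tabulate {xs = allFin n} (λ {x} _ → h x)))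

_∖_ : (ℕ → Bool) → ℕ → ℕ → Bool
(Q ∖ j) r = Q r ∧ not (r ≡ᵇ j)

T-∖⁻ : ∀ Q j r → T ((Q ∖ j) r) → T (Q r) × r ≢ j
T-∖⁻ Q j r t = let Qr , r≢ᵇj = to (T-∧ {Q r}) t in
  Qr , λ r≡j → contradiction (≡⇒≡ᵇ r j r≡j) (subst T (to T-not-≡ r≢ᵇj))

T-∖⁺ : ∀ Q j r → T (Q r) → r ≢ j → T ((Q ∖ j) r)
T-∖⁺ Q j r Qr r≢j = from (T-∧ {Q r}) (Qr , from T-not-≡ (¬T⇒≡false (r≢j ∘ ≡ᵇ⇒≡ r j)))

∑ : {A : Set} → List A → (A → ℕ) → ℕ
∑ xs f = sum (map f xs)

module _ {A : Set} where

  ∑-cong : ∀ xs {f g : A → ℕ} → (∀ {x} → x ∈ xs → f x ≡ g x) → ∑ xs f ≡ ∑ xs g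
  ∑-cong []       eq = refl
  ∑-cong (x ∷ xs) eq = cong₂ _+_ (eq (here refl)) (∑-cong xs (eq ∘ there))

  ∑-zero : ∀ xs {f : A → ℕ} → (∀ {x} → x ∈ xs → f x ≡ 0) → ∑ xs f ≡ 0
  ∑-zero []       eq = refl
  ∑-zero (x ∷ xs) eq = cong₂ _+_ (eq (here refl)) (∑-zero xs (eq ∘ there))

  ∑-distrib-+ : ∀ xs (f g : A → ℕ) → ∑ xs (λ x → f x + g x) ≡ ∑ xs f + ∑ xs g
  ∑-distrib-+ []       f g = refl
  ∑-distrib-+ (x ∷ xs) f g =
    trans (cong (f x + g x +_) (∑-distrib-+ xs f g)) (interchange (f x) (g x) (∑ xs f) (∑ xs g))

  ∑-++ : ∀ xs ys (f : A → ℕ) → ∑ (xs ++ ys) f ≡ ∑ xs f + ∑ ys f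
  ∑-++ xs ys f = trans (cong sum (map-++ f xs ys)) (sum-++ (map f xs) (map f ys))

  ∑-map : ∀ {B : Set} (g : B → A) xs (f : A → ℕ) → ∑ (map g xs) f ≡ ∑ xs (f ∘ g)
  ∑-map g xs f = cong sum (sym (map-∘ xs))

  ∑-single : ∀ {xs z} {f : A → ℕ} → Unique xs → z ∈ xs →
             (∀ {y} → y ∈ xs → y ≢ z → f y ≡ 0) → ∑ xs f ≡ f z
  ∑-single {x ∷ xs} {f = f} (x∉xs ∷ _) (here refl) vanish =
    trans (cong (f x +_) (∑-zero xs (λ y∈xs → vanish (there y∈xs) (≢-sym (All.lookup x∉xs y∈xs)))))
          (+-identityʳ (f x))
  ∑-single {x ∷ xs} {f = f} (x∉xs ∷ u) (there z∈xs) vanish =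
    trans (cong (_+ ∑ xs f) (vanish (here refl) (λ { refl → All.lookup x∉xs z∈xs refl })))
          (∑-single u z∈xs (vanish ∘ there))

  ∑-indicator : ∀ xs (p : A → Bool) → ∑ xs (indicator ∘ p) ≡ length (filter (T? ∘ p) xs)
  ∑-indicator []       p = refl
  ∑-indicator (x ∷ xs) p with p x
  ... | true  = cong suc (∑-indicator xs p)
  ... | false = ∑-indicator xs p

  ∑-ones : ∀ xs {f : A → ℕ} → (∀ {x} → x ∈ xs → f x ≡ 1) → ∑ xs f ≡ length xs
  ∑-ones []       eq = refl
  ∑-ones (x ∷ xs) eq = cong₂ _+_ (eq (here refl)) (∑-ones xs (eq ∘ there))

∑-comm : ∀ {A B : Set} (xs : List A) (ys : List B) (f : A → B → ℕ) →
         ∑ xs (λ x → ∑ ys (f x)) ≡ ∑ ys (λ y → ∑ xs (λ x → f x y))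
∑-comm []       ys f = sym (∑-zero ys (λ _ → refl))
∑-comm (x ∷ xs) ys f = trans (cong (∑ ys (f x) +_) (∑-comm xs ys f))
                             (sym (∑-distrib-+ ys (f x) (λ y → ∑ xs (λ x → f x y))))

module _ {A B : Set} {f : A → ℕ} {g : B → ℕ} where

  ∑-≤-∑ : ∀ {xs ys} → length xs ≤ length ys →
          (∀ {x y} → x ∈ xs → y ∈ ys → f x ≤ g y) → ∑ xs f ≤ ∑ ys g
  ∑-≤-∑ {[]}     {ys}     _         _  = z≤n
  ∑-≤-∑ {x ∷ xs} {y ∷ ys} (s≤s len) le =
    +-mono-≤ (le (here refl) (here refl)) (∑-≤-∑ len (λ x∈ y∈ → le (there x∈) (there y∈)))

  ∑-<-∑ : ∀ {xs ys} → length xs < length ys →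
          (∀ {x y} → x ∈ xs → y ∈ ys → f x ≤ g y) → (∀ {y} → y ∈ ys → 0 < g y) → ∑ xs f < ∑ ys g
  ∑-<-∑ {[]}     {y ∷ ys} _         _  pos = <-≤-trans (pos (here refl)) (m≤m+n (g y) _)
  ∑-<-∑ {x ∷ xs} {y ∷ ys} (s≤s len) le pos =
    +-mono-≤-< (le (here refl) (here refl))
               (∑-<-∑ len (λ x∈ y∈ → le (there x∈) (there y∈)) (pos ∘ there))

unique⇒↭-strictlySorted : ∀ {J} → Unique J → ∃[ J̃ ] AllPairs _<_ J̃ × J̃ ↭ J
unique⇒↭-strictlySorted {J} unique =
  sort J , AllPairs.zipWith (uncurry ≤∧≢⇒<) (Sorted⇒AllPairs ≤-totalOrder (sort-↗ J) , sorted-unique) , sort-↭ J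
  where
    sorted-unique : Unique (sort J)
    sorted-unique = AllPairs-resp-↭ ≢-sym (resp₂ _≢_) (↭⇒↭ₛ (↭-sym (sort-↭ J))) unique

↭⇒∈-⇔ : ∀ {A : Set} {xs ys : List A} {x} → xs ↭ ys → x ∈ xs ⇔ x ∈ ys
↭⇒∈-⇔ xs↭ys = mk⇔ (∈-resp-↭ xs↭ys) (∈-resp-↭ (↭-sym xs↭ys))

∈-map-∸ : ∀ {s r J} → All (s ≤_) J → r ∈ map (_∸ s) J ⇔ r + s ∈ J
∈-map-∸ {s} {r} {J} s≤J = mk⇔
  (λ r∈ → let j , j∈J , r≡j∸s = ∈-map⁻ (_∸ s) r∈ in
    subst (_∈ J) (sym (trans (cong (_+ s) r≡j∸s) (m∸n+n≡m (All.lookup s≤J j∈J)))) j∈J)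
  (λ r+s∈J → subst (_∈ map (_∸ s) J) (m+n∸n≡m r s) (∈-map⁺ (_∸ s) r+s∈J))

raise-lower-bound : ∀ {i j n J} → All (j <_) J → All (λ r → i < r × r ≤ n) J → All (λ r → j < r × r ≤ n) J
raise-lower-bound j<J bounds = All.zipWith (λ (j<r , (_ , r≤n)) → j<r , r≤n) (j<J , bounds)

∣insert∣ : ∀ {m} (x : Fin m) (M : Subset m) → ¬ T (lookup M x) → ∣ M [ x ]≔ true ∣ ≡ suc ∣ M ∣
∣insert∣ zero    (false ∷ M) x∉M = refl
∣insert∣ zero    (true  ∷ M) x∉M = contradiction _ x∉M
∣insert∣ (suc x) (false ∷ M) x∉M = ∣insert∣ x M x∉M
∣insert∣ (suc x) (true  ∷ M) x∉M = cong suc (∣insert∣ x M x∉M)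

suc∣remove∣ : ∀ {m} (x : Fin m) (M : Subset m) → T (lookup M x) → suc ∣ M [ x ]≔ false ∣ ≡ ∣ M ∣
suc∣remove∣ zero    (true  ∷ M) x∈M = refl
suc∣remove∣ (suc x) (false ∷ M) x∈M = suc∣remove∣ x M x∈M
suc∣remove∣ (suc x) (true  ∷ M) x∈M = cong suc (suc∣remove∣ x M x∈M)

∣M∣≡0⇒M≡∅ : ∀ {m} (M : Subset m) → ∣ M ∣ ≡ 0 → M ≡ ∅
∣M∣≡0⇒M≡∅ []          _  = refl
∣M∣≡0⇒M≡∅ (false ∷ M) eq = cong (false ∷_) (∣M∣≡0⇒M≡∅ M eq)

∉∅ : ∀ {m} (x : Fin m) → ¬ T (lookup (∅ {m}) x)
∉∅ x t = subst T (lookup-replicate x false) t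

∣M∣≡1⇒M≡⁅x⁆ : ∀ {m} (x : Fin m) (M : Subset m) → T (lookup M x) → ∣ M ∣ ≡ 1 → M ≡ ⁅ x ⁆
∣M∣≡1⇒M≡⁅x⁆ zero    (true  ∷ M) _   eq = cong (true ∷_) (∣M∣≡0⇒M≡∅ M (suc-injective eq))
∣M∣≡1⇒M≡⁅x⁆ (suc x) (false ∷ M) x∈M eq = cong (false ∷_) (∣M∣≡1⇒M≡⁅x⁆ x M x∈M eq)
∣M∣≡1⇒M≡⁅x⁆ (suc x) (true  ∷ M) x∈M eq =
  contradiction (subst (λ N → T (lookup N x)) (∣M∣≡0⇒M≡∅ M (suc-injective eq)) x∈M) (∉∅ x)

0<∣M∣⇒nonempty : ∀ {m} (M : Subset m) → 0 < ∣ M ∣ → ∃[ x ] T (lookup M x)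
0<∣M∣⇒nonempty (true  ∷ M) _  = zero , _
0<∣M∣⇒nonempty (false ∷ M) 0< = let x , x∈M = 0<∣M∣⇒nonempty M 0< in suc x , x∈M

maxList-upper : ∀ {x} xs → x ∈ xs → x ≤ foldr _⊔_ 0 xs
maxList-upper (y ∷ xs) (here refl) = m≤m⊔n y _
maxList-upper (y ∷ xs) (there x∈)  = ≤-trans (maxList-upper xs x∈) (m≤n⊔m y _)

maxList-sel : ∀ xs → foldr _⊔_ 0 xs ≡ 0 ⊎ foldr _⊔_ 0 xs ∈ xs
maxList-sel = foldr-selective ⊔-sel 0

module _ (P : FinPoset) where

  open FinPoset P using (size; le) renaming (refl to ≼-refl; antisym to ≼-antisym; trans to ≼-trans)

  infix 4 _∈ₛ_ _≼_ _≺_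

  _∈ₛ_ : Elt P → Subset size → Set
  x ∈ₛ S = T (lookup S x)

  _≼_ _≺_ : Elt P → Elt P → Set
  x ≼ y = T (le x y)
  x ≺ y = x ≼ y × x ≢ y

  Comparable : Elt P → Elt P → Set
  Comparable x y = x ≼ y ⊎ y ≼ x

  Chain : Subset size → Set
  Chain S = ∀ {x y} → x ∈ₛ S → y ∈ₛ S → Comparable x y

  StrictlyBelow : Elt P → Subset size → Set
  StrictlyBelow x S = ∀ {y} → y ∈ₛ S → y ≺ x

  ≺-trans : ∀ {x y z} → x ≺ y → y ≺ z → x ≺ z
  ≺-trans {x} {y} {z} (x≼y , x≢y) (y≼z , y≢z) =
    ≼-trans x y z x≼y y≼z , λ { refl → x≢y (≼-antisym x y x≼y y≼z) }

  ≺-irrefl : ∀ {x} → ¬ x ≺ x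
  ≺-irrefl (_ , x≢x) = x≢x refl

  x∈ₛ⁅x⁆ : ∀ x → x ∈ₛ ⁅ x ⁆
  x∈ₛ⁅x⁆ x = from T-≡ ([]=⇒lookup (x∈⁅x⁆ x))

  y∈ₛ⁅x⁆⇒y≡x : ∀ x y → y ∈ₛ ⁅ x ⁆ → y ≡ x
  y∈ₛ⁅x⁆⇒y≡x x y t = x∈⁅y⁆⇒x≡y x (lookup⇒[]= y ⁅ x ⁆ (to T-≡ t))

  x∈ₛinsert : ∀ x M → x ∈ₛ M [ x ]≔ true
  x∈ₛinsert x M = from T-≡ (lookup∘update x M true)

  ∈ₛ-insert⁺ : ∀ {x y} M → y ∈ₛ M → y ∈ₛ M [ x ]≔ true
  ∈ₛ-insert⁺ {x} {y} M y∈M with y ≟ x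
  ... | yes refl = x∈ₛinsert x M
  ... | no  y≢x  = subst T (sym (lookup∘update′ y≢x M true)) y∈M

  ∈ₛ-insert⁻ : ∀ {x y} M → y ∈ₛ M [ x ]≔ true → y ≡ x ⊎ y ∈ₛ M
  ∈ₛ-insert⁻ {x} {y} M y∈M′ with y ≟ x
  ... | yes y≡x = inj₁ y≡x
  ... | no  y≢x = inj₂ (subst T (lookup∘update′ y≢x M true) y∈M′)

  ∈ₛ-remove⁻ : ∀ {x y} M → y ∈ₛ M [ x ]≔ false → y ≢ x × y ∈ₛ M
  ∈ₛ-remove⁻ {x} {y} M y∈M′ with y ≟ x
  ... | yes refl = contradiction (subst T (lookup∘update x M false) y∈M′) λ ()
  ... | no  y≢x  = y≢x , subst T (lookup∘update′ y≢x M false) y∈M′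

  isChainB-⇔ : ∀ S → T (isChainB P S) ⇔ Chain S
  isChainB-⇔ S = mk⇔
    (λ t {x} {y} x∈S y∈S → to T-∨ (to T-→ (to (T-all-allFin (pair x)) (to (T-all-allFin row) t x) y)
                                            (from T-∧ (x∈S , y∈S))))
    (λ c → from (T-all-allFin row) λ x → from (T-all-allFin (pair x)) λ y → from T-→ λ t →
             let x∈S , y∈S = to T-∧ t in from T-∨ (c x∈S y∈S))
    where
      pair : Elt P → Elt P → Bool
      pair x y = not (mem P S x ∧ mem P S y) ∨ (le x y ∨ le y x)
      row : Elt P → Bool
      row x = all (pair x) (allFin size)

  ltB-⇔ : ∀ x y → T (ltB P x y) ⇔ x ≺ y
  ltB-⇔ x y with x ≟ y
  ... | yes x≡y = mk⇔ (λ t → contradiction (proj₂ (to (T-∧ {le x y}) t)) λ ())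
                       (λ x≺y → contradiction x≡y (proj₂ x≺y))
  ... | no  x≢y = mk⇔ (λ t → proj₁ (to (T-∧ {le x y}) t) , x≢y) (λ x≺y → from T-∧ (proj₁ x≺y , _))

  belowB-⇔ : ∀ x S → T (belowB P x S) ⇔ StrictlyBelow x S
  belowB-⇔ x S = mk⇔
    (λ t {y} y∈S → to (ltB-⇔ y x) (to T-→ (to (T-all-allFin below) t y) y∈S))
    (λ b → from (T-all-allFin below) λ y → from T-→ λ y∈S → from (ltB-⇔ y x) (b y∈S))
    where
      below : Elt P → Bool
      below y = not (mem P S y) ∨ ltB P y x

  allSubsets-complete : ∀ {m} (S : Subset m) → S ∈ allSubsets P m
  allSubsets-complete []          = here refl
  allSubsets-complete (false ∷ S) = ∈-++⁺ˡ (∈-map⁺ (false ∷_) (allSubsets-complete S))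
  allSubsets-complete {suc m} (true ∷ S) =
    ∈-++⁺ʳ (map (false ∷_) (allSubsets P m)) (∈-map⁺ (true ∷_) (allSubsets-complete S))

  allSubsets-unique : ∀ m → Unique (allSubsets P m)
  allSubsets-unique zero    = [] ∷ []
  allSubsets-unique (suc m) =
    Unique.++⁺ (Unique.map⁺ ∷-injectiveʳ (allSubsets-unique m))
               (Unique.map⁺ ∷-injectiveʳ (allSubsets-unique m))
               λ (S∈ˡ , S∈ʳ) → let _ , _ , eqˡ = ∈-map⁻ (false ∷_) S∈ˡ
                                   _ , _ , eqʳ = ∈-map⁻ (true ∷_) S∈ʳ
                               in contradiction (∷-injectiveˡ (trans (sym eqˡ) eqʳ)) λ ()

  ∑-allSubsets-suc : ∀ {m} (f : Subset (suc m) → ℕ) →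
    ∑ (allSubsets P (suc m)) f ≡
    ∑ (allSubsets P m) (λ S → f (false ∷ S)) + ∑ (allSubsets P m) (λ S → f (true ∷ S))
  ∑-allSubsets-suc {m} f =
    trans (∑-++ (map (false ∷_) (allSubsets P m)) _ f)
          (cong₂ _+_ (∑-map (false ∷_) (allSubsets P m) f) (∑-map (true ∷_) (allSubsets P m) f))

  ∑-insert : ∀ {m} (x : Fin m) (g : Subset m → ℕ) →
    ∑ (allSubsets P m) (λ M → if lookup M x then g M else 0) ≡
    ∑ (allSubsets P m) (λ M → if lookup M x then 0 else g (M [ x ]≔ true))
  ∑-insert {suc m} zero g =
    trans (∑-allSubsets-suc (λ M → if lookup M zero then g M else 0))
          (trans (+-comm (∑ (allSubsets P m) (λ _ → 0)) _)
                 (sym (∑-allSubsets-suc (λ M → if lookup M zero then 0 else g (M [ zero ]≔ true)))))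
  ∑-insert {suc m} (suc x) g =
    trans (∑-allSubsets-suc (λ M → if lookup M (suc x) then g M else 0))
          (trans (cong₂ _+_ (∑-insert x (λ S → g (false ∷ S))) (∑-insert x (λ S → g (true ∷ S))))
                 (sym (∑-allSubsets-suc (λ M → if lookup M (suc x) then 0 else g (M [ suc x ]≔ true)))))

  chains-complete : ∀ S → Chain S → S ∈ chains P
  chains-complete S c = ∈-filter⁺ (λ S → T? (isChainB P S)) (allSubsets-complete S) (from (isChainB-⇔ S) c)

  ∈-chains⁻ : ∀ {S} → S ∈ chains P → Chain S
  ∈-chains⁻ {S} S∈ =
    to (isChainB-⇔ S) (proj₂ (∈-filter⁻ (λ S → T? (isChainB P S)) {xs = allSubsets P size} S∈))

  insert-chain : ∀ {x} S → Chain S → (∀ {v} → v ∈ₛ S → Comparable x v) → Chain (S [ x ]≔ true)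
  insert-chain {x} S c x~ {u} {v} u∈ v∈ with ∈ₛ-insert⁻ S u∈ | ∈ₛ-insert⁻ S v∈
  ... | inj₁ refl | inj₁ refl = inj₁ (≼-refl u)
  ... | inj₁ refl | inj₂ v∈S  = x~ v∈S
  ... | inj₂ u∈S  | inj₁ refl = swap (x~ u∈S)
  ... | inj₂ u∈S  | inj₂ v∈S  = c u∈S v∈S

  rank-upper : ∀ {x} S → Chain S → StrictlyBelow x S → ∣ S ∣ ≤ rank P x
  rank-upper {x} S c b = maxList-upper _ (∈-map⁺ ∣_∣
    (∈-filter⁺ (λ S → T? (belowB P x S)) (chains-complete S c) (from (belowB-⇔ x S) b)))

  rank-attained : ∀ x → ∃[ S ] Chain S × StrictlyBelow x S × ∣ S ∣ ≡ rank P x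
  rank-attained x with maxList-sel (map ∣_∣ (filter (λ S → T? (belowB P x S)) (chains P)))
  ... | inj₁ r≡0 = ∅ , (λ {u} u∈ → contradiction u∈ (∉∅ u)) , (λ {u} u∈ → contradiction u∈ (∉∅ u)) ,
                   trans (∣⊥∣≡0 size) (sym r≡0)
  ... | inj₂ r∈  = let S , S∈ , r≡∣S∣ = ∈-map⁻ ∣_∣ r∈
                       S∈chains , S-below = ∈-filter⁻ (λ S → T? (belowB P x S)) {xs = chains P} S∈
                   in S , ∈-chains⁻ S∈chains , to (belowB-⇔ x S) S-below , sym r≡∣S∣

  height-attained : ∀ {n} → height P ≡ suc n → ∃[ C ] Chain C × ∣ C ∣ ≡ suc n
  height-attained eq with maxList-sel (map ∣_∣ (chains P))
  ... | inj₁ h≡0 = contradiction (trans (sym h≡0) eq) λ ()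
  ... | inj₂ h∈  = let C , C∈ , h≡∣C∣ = ∈-map⁻ ∣_∣ h∈ in C , ∈-chains⁻ C∈ , trans (sym h≡∣C∣) eq

  rank-strictMono : ∀ {x y} → x ≺ y → rank P x < rank P y
  rank-strictMono {x} {y} x≺y with rank-attained x
  ... | S , c , b , ∣S∣≡ =
    subst (_≤ rank P y) (trans (∣insert∣ x S (≺-irrefl ∘ b)) (cong suc ∣S∣≡))
          (rank-upper (S [ x ]≔ true) (insert-chain S c (λ v∈ → inj₂ (proj₁ (b v∈)))) below)
    where
      below : StrictlyBelow y (S [ x ]≔ true)
      below u∈ with ∈ₛ-insert⁻ S u∈
      ... | inj₁ refl = x≺y
      ... | inj₂ u∈S  = ≺-trans (b u∈S) x≺y

  comparable-rank : ∀ {x z} → Comparable x z → rank P x < rank P z → x ≺ z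
  comparable-rank (inj₁ x≼z) r< = x≼z , λ { refl → <-irrefl refl r< }
  comparable-rank {x} {z} (inj₂ z≼x) r< with z ≟ x
  ... | yes refl = contradiction r< (<-irrefl refl)
  ... | no  z≢x  = contradiction r< (<-asym (rank-strictMono (z≼x , z≢x)))

  chain-rank-injective : ∀ S {x y} → Chain S → x ∈ₛ S → y ∈ₛ S → rank P x ≡ rank P y → x ≡ y
  chain-rank-injective S {x} {y} c x∈ y∈ r≡ with x ≟ y
  ... | yes x≡y = x≡y
  ... | no  x≢y with c x∈ y∈
  ...   | inj₁ x≼y = contradiction r≡ (<⇒≢ (rank-strictMono (x≼y , x≢y)))
  ...   | inj₂ y≼x = contradiction (sym r≡) (<⇒≢ (rank-strictMono (y≼x , x≢y ∘ sym)))

  top-element : ∀ S {a} → Chain S → a ∈ₛ S → ∃[ t ] t ∈ₛ S × (∀ {u} → u ∈ₛ S → u ≼ t)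
  top-element S {a} c a∈S = t , t∈S , below-t
    where
      elements = filter (λ y → T? (lookup S y)) (allFin size)
      t = argmax (rank P) a elements
      t∈S : t ∈ₛ S
      t∈S = argmax-all (rank P) a∈S
              (All.tabulate (λ y∈ → proj₂ (∈-filter⁻ (λ y → T? (lookup S y)) {xs = allFin size} y∈)))
      below-t : ∀ {u} → u ∈ₛ S → u ≼ t
      below-t {u} u∈S with c u∈S t∈S | t ≟ u
      ... | inj₁ u≼t | _        = u≼t
      ... | inj₂ _   | yes refl = ≼-refl t
      ... | inj₂ t≼u | no  t≢u  = contradiction (rank-strictMono (t≼u , t≢u)) (≤⇒≯ (All.lookup
              (f[xs]≤f[argmax] a elements) (∈-filter⁺ (λ y → T? (lookup S y)) (∈-allFin u) u∈S)))

  rank-of-top : ∀ S {r} → Chain S → ∣ S ∣ ≡ suc r → ∃[ t ] t ∈ₛ S × r ≤ rank P t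
  rank-of-top S c ∣S∣≡ with 0<∣M∣⇒nonempty S (subst (0 <_) (sym ∣S∣≡) z<s)
  ... | a , a∈S with top-element S c a∈S
  ...   | t , t∈S , top =
    t , t∈S , subst (_≤ rank P t) (suc-injective (trans (suc∣remove∣ t S t∈S) ∣S∣≡))
                    (rank-upper (S [ t ]≔ false) chain below)
    where
      chain : Chain (S [ t ]≔ false)
      chain u∈ v∈ = c (proj₂ (∈ₛ-remove⁻ S u∈)) (proj₂ (∈ₛ-remove⁻ S v∈))
      below : StrictlyBelow t (S [ t ]≔ false)
      below u∈ = let u≢t , u∈S = ∈ₛ-remove⁻ S u∈ in top u∈S , u≢t

  rank-predecessor : ∀ {w r} → rank P w ≡ suc r → ∃[ t ] rank P t ≡ r
  rank-predecessor {w} {r} r≡ with rank-attained w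
  ... | S , c , b , ∣S∣≡ with rank-of-top S c (trans ∣S∣≡ r≡)
  ...   | t , t∈S , r≤ = t , ≤-antisym (≤-pred (subst (rank P t <_) r≡ (rank-strictMono (b t∈S)))) r≤

  rank-descend : ∀ d {w r} → rank P w ≡ r + d → ∃[ u ] rank P u ≡ r
  rank-descend zero    {w} {r} r≡ = w , trans r≡ (+-identityʳ r)
  rank-descend (suc d) {r = r} r≡ =
    let t , t-rank = rank-predecessor (trans r≡ (+-suc r d)) in rank-descend d t-rank

  rank-surjective : ∀ {n r} → height P ≡ suc n → r ≤ n → ∃[ u ] rank P u ≡ r
  rank-surjective {n} {r} h≡ r≤n with height-attained h≡
  ... | C , c , ∣C∣≡ with rank-of-top C c ∣C∣≡
  ...   | t , _ , n≤ = rank-descend (rank P t ∸ r) (sym (m+[n∸m]≡n (≤-trans r≤n n≤)))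

  -- countedB k ⁅ x ⁆ J with the rank condition inJ J generalised to a predicate Q on ranks, so that
  -- c′ P k ⁅ x ⁆ J is definitionally count k x (inJ P J)
  counted : ℕ → Elt P → (ℕ → Bool) → Subset size → Bool
  counted k x Q M = isChainB P M ∧ (∣ M ∣ ≡ᵇ k) ∧ subsetB P ⁅ x ⁆ M
    ∧ all (λ y → not (mem P M y ∧ not (mem P ⁅ x ⁆ y)) ∨ Q (rank P y)) (allFin size)

  count : ℕ → Elt P → (ℕ → Bool) → ℕ
  count k x Q = length (filter (T? ∘ counted k x Q) (allSubsets P size))

  Counted : ℕ → Elt P → (ℕ → Bool) → Subset size → Set
  Counted k x Q M = Chain M × ∣ M ∣ ≡ k × x ∈ₛ M × (∀ {y} → y ∈ₛ M → y ≢ x → T (Q (rank P y)))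

  counted-⇔ : ∀ k x Q M → T (counted k x Q M) ⇔ Counted k x Q M
  counted-⇔ k x Q M = mk⇔ forward backward
    where
      contains ranked : Elt P → Bool
      contains y = not (mem P ⁅ x ⁆ y) ∨ mem P M y
      ranked   y = not (mem P M y ∧ not (mem P ⁅ x ⁆ y)) ∨ Q (rank P y)

      forward : T (counted k x Q M) → Counted k x Q M
      forward t =
        let chain , t₁ = to T-∧ t ; size≡ , t₂ = to T-∧ t₁ ; ⁅x⁆⊆M , rank-ok = to T-∧ t₂ in
        to (isChainB-⇔ M) chain , ≡ᵇ⇒≡ _ _ size≡ ,
        to T-→ (to (T-all-allFin contains) ⁅x⁆⊆M x) (x∈ₛ⁅x⁆ x) ,
        λ {y} y∈M y≢x → to T-→ (to (T-all-allFin ranked) rank-ok y)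
                               (from T-∧ (y∈M , from T-not-≡ (¬T⇒≡false (y≢x ∘ y∈ₛ⁅x⁆⇒y≡x x y))))

      backward : Counted k x Q M → T (counted k x Q M)
      backward (chain , size≡ , x∈M , rank-ok) =
        from T-∧ (from (isChainB-⇔ M) chain , from T-∧ (≡⇒≡ᵇ _ _ size≡ , from T-∧
          ( from (T-all-allFin contains) (λ y → from T-→ λ y∈⁅x⁆ →
              subst (_∈ₛ M) (sym (y∈ₛ⁅x⁆⇒y≡x x y y∈⁅x⁆)) x∈M)
          , from (T-all-allFin ranked) (λ y → from T-→ λ t →
              let y∈M , y∉⁅x⁆ = to T-∧ t in
              rank-ok y∈M λ { refl → contradiction (to T-not-≡ y∉⁅x⁆) (λ eq → subst T eq (x∈ₛ⁅x⁆ x)) }))))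

  count≡∑ : ∀ k x Q → count k x Q ≡ ∑ (allSubsets P size) (indicator ∘ counted k x Q)
  count≡∑ k x Q = sym (∑-indicator (allSubsets P size) (counted k x Q))

  count-cong : ∀ k x {Q Q′ : ℕ → Bool} → (∀ r → Q r ≡ Q′ r) → count k x Q ≡ count k x Q′
  count-cong k x {Q} {Q′} Q≗Q′ =
    trans (count≡∑ k x Q)
          (trans (∑-cong (allSubsets P size) (λ {M} _ → cong indicator (counted-cong M))) (sym (count≡∑ k x Q′)))
    where
      counted-cong : ∀ M → counted k x Q M ≡ counted k x Q′ M
      counted-cong M = cong (λ b → isChainB P M ∧ (∣ M ∣ ≡ᵇ k) ∧ subsetB P ⁅ x ⁆ M ∧ b)
        (cong and (map-cong (λ y → cong (not (mem P M y ∧ not (mem P ⁅ x ⁆ y)) ∨_) (Q≗Q′ (rank P y)))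
                            (allFin size)))

  count-one : ∀ z Q → count 1 z Q ≡ 1
  count-one z Q = trans (count≡∑ 1 z Q) (trans
    (∑-single (allSubsets-unique size) (allSubsets-complete ⁅ z ⁆) vanish)
    (indicator-T (from (counted-⇔ 1 z Q ⁅ z ⁆)
      (chain , ∣⁅x⁆∣≡1 z , x∈ₛ⁅x⁆ z , λ {y} y∈ y≢z → contradiction (y∈ₛ⁅x⁆⇒y≡x z y y∈) y≢z))))
    where
      chain : Chain ⁅ z ⁆
      chain {u} {v} u∈ v∈ with y∈ₛ⁅x⁆⇒y≡x z u u∈ | y∈ₛ⁅x⁆⇒y≡x z v v∈
      ... | refl | refl = inj₁ (≼-refl z)
      vanish : ∀ {M} → M ∈ allSubsets P size → M ≢ ⁅ z ⁆ → indicator (counted 1 z Q M) ≡ 0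
      vanish {M} _ M≢⁅z⁆ = indicator-¬T λ t →
        let _ , ∣M∣≡1 , z∈M , _ = to (counted-⇔ 1 z Q M) t in M≢⁅z⁆ (∣M∣≡1⇒M≡⁅x⁆ z M z∈M ∣M∣≡1)

  count-vacuous : ∀ {k} x Q → 2 ≤ k → (∀ r → ¬ T (Q r)) → count k x Q ≡ 0
  count-vacuous {k} x Q 2≤k ¬Q =
    trans (count≡∑ k x Q)
          (∑-zero (allSubsets P size) λ {M} _ → indicator-¬T (uncounted M ∘ to (counted-⇔ k x Q M)))
    where
      uncounted : ∀ M → ¬ Counted k x Q M
      uncounted M (_ , ∣M∣≡k , x∈M , rank-ok) with ∣ M [ x ]≔ false ∣ in ∣M′∣≡
      ... | zero  = contradiction (subst (2 ≤_) k≡1 2≤k) λ { (s≤s ()) }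
        where k≡1 = trans (sym ∣M∣≡k) (trans (sym (suc∣remove∣ x M x∈M)) (cong suc ∣M′∣≡))
      ... | suc _ =
        let y , y∈M′ = 0<∣M∣⇒nonempty (M [ x ]≔ false) (subst (0 <_) (sym ∣M′∣≡) z<s)
            y≢x , y∈M = ∈ₛ-remove⁻ M y∈M′
        in ¬Q _ (rank-ok y∈M y≢x)

  aboveAtRank : Elt P → ℕ → List (Elt P)
  aboveAtRank x j = filter (λ z → T? (ltB P x z ∧ (rank P z ≡ᵇ j))) (allFin size)

  ∈-aboveAtRank⁺ : ∀ {x z j} → x ≺ z → rank P z ≡ j → z ∈ aboveAtRank x j
  ∈-aboveAtRank⁺ {x} {z} {j} x≺z r≡ = ∈-filter⁺ (λ z → T? (ltB P x z ∧ (rank P z ≡ᵇ j))) (∈-allFin z)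
    (from T-∧ (from (ltB-⇔ x z) x≺z , ≡⇒≡ᵇ _ _ r≡))

  ∈-aboveAtRank⁻ : ∀ {x z j} → z ∈ aboveAtRank x j → x ≺ z × rank P z ≡ j
  ∈-aboveAtRank⁻ {x} {z} {j} z∈ =
    let x≺z , r≡ = to T-∧ (proj₂ (∈-filter⁻ (λ z → T? (ltB P x z ∧ (rank P z ≡ᵇ j))) {xs = allFin size} z∈))
    in to (ltB-⇔ x z) x≺z , ≡ᵇ⇒≡ _ _ r≡

  aboveAtRank-unique : ∀ x j → Unique (aboveAtRank x j)
  aboveAtRank-unique x j = Unique.filter⁺ (λ z → T? (ltB P x z ∧ (rank P z ≡ᵇ j))) (Unique.allFin⁺ size)

  module _ {x : Elt P} {Q : ℕ → Bool} {j : ℕ}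
           (Qj : T (Q j)) (j-least : ∀ {r} → T (Q r) → j ≤ r) (x<j : rank P x < j) where

    private
      subsets = allSubsets P size

      through : ℕ → Elt P → Subset size → ℕ
      through k z M = indicator (lookup M z ∧ counted k x Q M)

      ∖⁻ : ∀ r → T ((Q ∖ j) r) → T (Q r) × r ≢ j
      ∖⁻ = T-∖⁻ Q j

      ∖⁺ : ∀ r → T (Q r) → r ≢ j → T ((Q ∖ j) r)
      ∖⁺ = T-∖⁺ Q j

    counted-split : ∀ k M → indicator (counted k x Q M) ≡
      indicator (counted k x (Q ∖ j) M) + ∑ (aboveAtRank x j) (λ z → through k z M)
    counted-split k M with T? (counted k x Q M)
    ... | no ¬c = trans (indicator-¬T ¬c) (sym (cong₂ _+_
      (indicator-¬T (¬c ∘ weaken))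
      (∑-zero (aboveAtRank x j) λ {z} _ → indicator-¬T (¬c ∘ proj₂ ∘ to (T-∧ {lookup M z})))))
      where
        weaken : T (counted k x (Q ∖ j) M) → T (counted k x Q M)
        weaken t = let chain , size≡ , x∈M , rank-ok = to (counted-⇔ k x (Q ∖ j) M) t in
          from (counted-⇔ k x Q M) (chain , size≡ , x∈M , λ {y} y∈ y≢x → proj₁ (∖⁻ (rank P y) (rank-ok y∈ y≢x)))
    ... | yes c with counted-⇔ k x Q M | any? (λ z → T? (lookup M z)) (aboveAtRank x j)
    ...   | c⇔ | yes hit =
      let z₀ , z₀∈ , z₀∈M = find hit ; chain , _ , _ , _ = to c⇔ c ; x≺z₀ , z₀-rank = ∈-aboveAtRank⁻ z₀∈ in
      trans (indicator-T c) (sym (cong₂ _+_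
        (indicator-¬T λ t → let _ , _ , _ , rank-ok = to (counted-⇔ k x (Q ∖ j) M) t in
                            proj₂ (∖⁻ (rank P z₀) (rank-ok z₀∈M (≢-sym (proj₂ x≺z₀)))) z₀-rank)
        (trans (∑-single (aboveAtRank-unique x j) z₀∈ λ {y} y∈ y≢z₀ → indicator-¬T λ t →
                  y≢z₀ (chain-rank-injective M chain (proj₁ (to T-∧ t)) z₀∈M
                          (trans (proj₂ (∈-aboveAtRank⁻ y∈)) (sym z₀-rank))))
               (indicator-T (from T-∧ (z₀∈M , c))))))
    ...   | c⇔ | no miss =
      let chain , size≡ , x∈M , rank-ok = to c⇔ c in
      trans (indicator-T c) (sym (cong₂ _+_
        (indicator-T (from (counted-⇔ k x (Q ∖ j) M) (chain , size≡ , x∈M , λ {y} y∈M y≢x →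
           ∖⁺ (rank P y) (rank-ok y∈M y≢x) λ y-rank → miss (lose (∈-aboveAtRank⁺
             (comparable-rank (chain x∈M y∈M) (subst (rank P x <_) (sym y-rank) x<j)) y-rank) y∈M))))
        (∑-zero (aboveAtRank x j) λ {z} z∈ → indicator-¬T λ t →
           miss (lose z∈ (proj₁ (to (T-∧ {lookup M z}) t))))))

    extend-⇔ : ∀ {k z M} → x ≺ z → rank P z ≡ j → ¬ x ∈ₛ M →
      (z ∈ₛ M [ x ]≔ true × Counted (suc k) x Q (M [ x ]≔ true)) ⇔ Counted k z (Q ∖ j) M
    extend-⇔ {k} {z} {M} x≺z z-rank x∉M = mk⇔ forward backward
      where
        M′ = M [ x ]≔ true

        forward : z ∈ₛ M′ × Counted (suc k) x Q M′ → Counted k z (Q ∖ j) M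
        forward (z∈M′ , chain′ , size′ , _ , rank-ok′) =
          (λ u∈ v∈ → chain′ (∈ₛ-insert⁺ M u∈) (∈ₛ-insert⁺ M v∈)) ,
          suc-injective (trans (sym (∣insert∣ x M x∉M)) size′) ,
          z∈M , λ {y} y∈M y≢z → ∖⁺ (rank P y)
            (rank-ok′ (∈ₛ-insert⁺ M y∈M) (λ { refl → x∉M y∈M }))
            (λ y-rank → y≢z (chain-rank-injective M′ chain′ (∈ₛ-insert⁺ M y∈M) z∈M′ (trans y-rank (sym z-rank))))
          where
            z∈M : z ∈ₛ M
            z∈M = fromInj₂ (λ z≡x → contradiction (sym z≡x) (proj₂ x≺z)) (∈ₛ-insert⁻ M z∈M′)

        backward : Counted k z (Q ∖ j) M → z ∈ₛ M′ × Counted (suc k) x Q M′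
        backward (chain , size≡ , z∈M , rank-ok) =
          ∈ₛ-insert⁺ M z∈M , insert-chain M chain (inj₁ ∘ x≼) , trans (∣insert∣ x M x∉M) (cong suc size≡) ,
          x∈ₛinsert x M , rank-ok′
          where
            x≼ : ∀ {v} → v ∈ₛ M → x ≼ v
            x≼ {v} v∈M with v ≟ z
            ... | yes refl = proj₁ x≺z
            ... | no  v≢z  =
              let Qv , v-rank≢j = ∖⁻ (rank P v) (rank-ok v∈M v≢z)
                  z<v = subst (_< rank P v) (sym z-rank) (≤∧≢⇒< (j-least Qv) (v-rank≢j ∘ sym))
              in ≼-trans x z v (proj₁ x≺z) (proj₁ (comparable-rank (chain z∈M v∈M) z<v))
            rank-ok′ : ∀ {y} → y ∈ₛ M′ → y ≢ x → T (Q (rank P y))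
            rank-ok′ {y} y∈M′ y≢x with ∈ₛ-insert⁻ M y∈M′ | y ≟ z
            ... | inj₁ y≡x | _        = contradiction y≡x y≢x
            ... | inj₂ _   | yes refl = subst (T ∘ Q) (sym z-rank) Qj
            ... | inj₂ y∈M | no  y≢z  = proj₁ (∖⁻ (rank P y) (rank-ok y∈M y≢z))

    ∑-through : ∀ {k z} → x ≺ z → rank P z ≡ j →
      ∑ subsets (through (suc k) z) ≡ count k z (Q ∖ j)
    ∑-through {k} {z} x≺z z-rank = begin
      ∑ subsets (through (suc k) z)
        ≡⟨ ∑-cong subsets (λ {M} _ → through-x M) ⟩
      ∑ subsets (λ M → if lookup M x then through (suc k) z M else 0)
        ≡⟨ ∑-insert x _ ⟩
      ∑ subsets (λ M → if lookup M x then 0 else through (suc k) z (M [ x ]≔ true))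
        ≡⟨ ∑-cong subsets (λ {M} _ → remove-x M) ⟩
      ∑ subsets (indicator ∘ counted k z (Q ∖ j))
        ≡⟨ count≡∑ k z (Q ∖ j) ⟨
      count k z (Q ∖ j) ∎
      where
        open ≡-Reasoning
        through-x : ∀ M → through (suc k) z M ≡ (if lookup M x then through (suc k) z M else 0)
        through-x M with lookup M x in x∈?
        ... | true  = refl
        ... | false = indicator-¬T λ t →
          let _ , _ , x∈M , _ = to (counted-⇔ (suc k) x Q M) (proj₂ (to (T-∧ {lookup M z}) t)) in subst T x∈? x∈M
        remove-x : ∀ M → (if lookup M x then 0 else through (suc k) z (M [ x ]≔ true))
                         ≡ indicator (counted k z (Q ∖ j) M)
        remove-x M with lookup M x in x∈?
        ... | true  = sym (indicator-¬T λ t →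
          let _ , _ , _ , rank-ok = to (counted-⇔ k z (Q ∖ j) M) t
              Qx = proj₁ (∖⁻ (rank P x) (rank-ok (from T-≡ x∈?) (proj₂ x≺z)))
          in <⇒≱ x<j (j-least Qx))
        ... | false = cong indicator (T-injective (mk⇔
          (λ t → let z∈M′ , c = to (T-∧ {lookup M′ z}) t in
                 from (counted-⇔ k z (Q ∖ j) M) (to extended (z∈M′ , to (counted-⇔ (suc k) x Q M′) c)))
          (λ t → let z∈M′ , C = from extended (to (counted-⇔ k z (Q ∖ j) M) t) in
                 from (T-∧ {lookup M′ z}) (z∈M′ , from (counted-⇔ (suc k) x Q M′) C))))
          where
            M′ = M [ x ]≔ true
            extended = extend-⇔ {k} {z} {M} x≺z z-rank (λ x∈M → subst T x∈? x∈M)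

    count-decompose : ∀ k → count (suc k) x Q ≡
      count (suc k) x (Q ∖ j) + ∑ (aboveAtRank x j) (λ z → count k z (Q ∖ j))
    count-decompose k = begin
      count (suc k) x Q
        ≡⟨ count≡∑ (suc k) x Q ⟩
      ∑ subsets (indicator ∘ counted (suc k) x Q)
        ≡⟨ ∑-cong subsets (λ {M} _ → counted-split (suc k) M) ⟩
      ∑ subsets (λ M → indicator (counted (suc k) x (Q ∖ j) M) + ∑ zs (λ z → through (suc k) z M))
        ≡⟨ ∑-distrib-+ subsets _ _ ⟩
      ∑ subsets (indicator ∘ counted (suc k) x (Q ∖ j)) + ∑ subsets (λ M → ∑ zs (λ z → through (suc k) z M))
        ≡⟨ cong₂ _+_ (sym (count≡∑ (suc k) x (Q ∖ j))) (∑-comm subsets zs (λ M z → through (suc k) z M)) ⟩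
      count (suc k) x (Q ∖ j) + ∑ zs (λ z → ∑ subsets (through (suc k) z))
        ≡⟨ cong (count (suc k) x (Q ∖ j) +_) (∑-cong zs λ z∈ → uncurry ∑-through (∈-aboveAtRank⁻ z∈)) ⟩
      count (suc k) x (Q ∖ j) + ∑ zs (λ z → count k z (Q ∖ j)) ∎
      where
        open ≡-Reasoning
        zs = aboveAtRank x j

  T-inJ : ∀ J r → T (inJ P J r) ⇔ r ∈ J
  T-inJ J r = mk⇔ (Any.map (≡ᵇ⇒≡ r _) ∘ any⁻ (r ≡ᵇ_) J) (any⁺ (r ≡ᵇ_) ∘ Any.map (≡⇒≡ᵇ r _))

  inJ-≡ : ∀ J J′ {r r′} → r ∈ J ⇔ r′ ∈ J′ → inJ P J r ≡ inJ P J′ r′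
  inJ-≡ J J′ {r} {r′} r∈⇔ = T-injective (⇔-trans (T-inJ J r) (⇔-trans r∈⇔ (⇔-sym (T-inJ J′ r′))))

  -- the set J − s of the paper as a predicate on ranks (faithful only when all elements of J are ≥ s)
  shifted : List ℕ → ℕ → ℕ → Bool
  shifted J s r = inJ P J (r + s)

  count-decompose-head : ∀ {j J s x} k → All (j <_) J → s ≤ j → rank P x < j ∸ s →
    count (suc k) x (shifted (j ∷ J) s) ≡
    count (suc k) x (shifted J s) + ∑ (aboveAtRank x (j ∸ s)) (λ z → count k z (shifted J s))
  count-decompose-head {j} {J} {s} {x} k j<J s≤j x<j∸s =
    trans (count-decompose {Q = shifted (j ∷ J) s} Qj least x<j∸s k)
          (cong₂ _+_ (count-cong (suc k) x drop-head)
                     (∑-cong (aboveAtRank x (j ∸ s)) λ {z} _ → count-cong k z drop-head))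
    where
      j∸s+s≡j = m∸n+n≡m s≤j
      Qj : T (shifted (j ∷ J) s (j ∸ s))
      Qj = from (T-inJ (j ∷ J) _) (here j∸s+s≡j)
      least : ∀ {r} → T (shifted (j ∷ J) s r) → j ∸ s ≤ r
      least {r} t = subst (j ∸ s ≤_) (m+n∸n≡m r s) (∸-monoˡ-≤ s (head-least (to (T-inJ (j ∷ J) (r + s)) t)))
        where
          head-least : ∀ {r} → r ∈ j ∷ J → j ≤ r
          head-least (here refl) = ≤-refl
          head-least (there r∈J) = <⇒≤ (All.lookup j<J r∈J)
      drop-head : ∀ r → (shifted (j ∷ J) s ∖ (j ∸ s)) r ≡ shifted J s r
      drop-head r = T-injective (mk⇔
        (λ t → let r+s∈ , r≢j∸s = T-∖⁻ (shifted (j ∷ J) s) (j ∸ s) r t in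
          from (T-inJ J (r + s)) (case to (T-inJ (j ∷ J) (r + s)) r+s∈ of λ
            { (here r+s≡j) → contradiction (trans (sym (m+n∸n≡m r s)) (cong (_∸ s) r+s≡j)) r≢j∸s
            ; (there r+s∈J) → r+s∈J }))
        (λ t → let r+s∈J = to (T-inJ J (r + s)) t in
          T-∖⁺ (shifted (j ∷ J) s) (j ∸ s) r (from (T-inJ (j ∷ J) (r + s)) (there r+s∈J))
            λ r≡j∸s → <-irrefl (trans (sym j∸s+s≡j) (cong (_+ s) (sym r≡j∸s))) (All.lookup j<J r+s∈J)))

  count-pairs : ∀ {x j} → rank P x < j → c′ P 2 ⁅ x ⁆ [ j ] ≡ length (aboveAtRank x j)
  count-pairs {x} {j} x<j =
    trans (count-decompose {Q = inJ P [ j ]} Qj least x<j 1)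
          (cong₂ _+_ (count-vacuous x (inJ P [ j ] ∖ j) ≤-refl nothing-left)
                     (∑-ones (aboveAtRank x j) λ {z} _ → count-one z (inJ P [ j ] ∖ j)))
    where
      Qj : T (inJ P [ j ] j)
      Qj = from (T-inJ [ j ] j) (here refl)
      least : ∀ {r} → T (inJ P [ j ] r) → j ≤ r
      least {r} t with to (T-inJ [ j ] r) t
      ... | here refl = ≤-refl
      nothing-left : ∀ r → ¬ T ((inJ P [ j ] ∖ j) r)
      nothing-left r t with T-∖⁻ (inJ P [ j ]) j r t
      ... | t′ , r≢j = r≢j (case to (T-inJ [ j ] r) t′ of λ { (here r≡j) → r≡j })

  module _ {n : ℕ} (height≡ : height P ≡ suc n) where

    below-height : ∀ {j} → j ≤ n → suc j ≤ height P
    below-height j≤n = subst (_ ≤_) (sym height≡) (s≤s j≤n)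

    -- step is Descending P when _≲_ is _≤_, and StrictlyDescending P when it is _<_
    module _ (_≲_ : ℕ → ℕ → Set) (≲-trans : ∀ {a b c} → a ≲ b → b ≲ c → a ≲ c)
             (step : ∀ i j → 0 < i → i < j → suc j ≤ height P → ∀ x y → rank P x ≡ i → rank P y ≡ i ∸ 1 →
                     c′ P 2 ⁅ x ⁆ [ j ] ≲ c′ P 2 ⁅ y ⁆ [ j ∸ 1 ]) where

      step-iterate : ∀ s {i j x y} → 1 ≤ s → s ≤ i → i < j → j ≤ n → rank P x ≡ i → rank P y ≡ i ∸ s →
                     c′ P 2 ⁅ x ⁆ [ j ] ≲ c′ P 2 ⁅ y ⁆ [ j ∸ s ]
      step-iterate (suc zero) {i} {j} {x} {y} _ 1≤i i<j j≤n x-rank y-rank =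
        step i j 1≤i i<j (below-height j≤n) x y x-rank y-rank
      step-iterate (suc (suc s)) {i} {j} {x} {y} _ s+2≤i i<j j≤n x-rank y-rank =
        ≲-trans (step-iterate (suc s) (s≤s z≤n) (≤-trans (n≤1+n _) s+2≤i) i<j j≤n x-rank u-rank)
                (subst (λ t → c′ P 2 ⁅ u ⁆ [ j ∸ suc s ] ≲ c′ P 2 ⁅ y ⁆ [ t ]) (∸-suc j (suc s))
                   (step (i ∸ suc s) (j ∸ suc s) (m<n⇒0<n∸m s+2≤i) (∸-monoˡ-< i<j (≤-trans (n≤1+n _) s+2≤i))
                         (below-height (≤-trans (m∸n≤m j (suc s)) j≤n)) u y u-rank
                         (trans y-rank (sym (∸-suc i (suc s))))))
        where
          ∸-suc : ∀ m k → m ∸ k ∸ 1 ≡ m ∸ suc k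
          ∸-suc m k = trans (∸-+-assoc m k 1) (cong (m ∸_) (+-comm k 1))
          u-exists = rank-surjective height≡ (≤-trans (m∸n≤m i (suc s)) (≤-trans (<⇒≤ i<j) j≤n))
          u = proj₁ u-exists
          u-rank = proj₂ u-exists

      pairs-≲ : ∀ {s i j x y} → 1 ≤ s → s ≤ i → i < j → j ≤ n → rank P x ≡ i → rank P y ≡ i ∸ s →
                length (aboveAtRank x j) ≲ length (aboveAtRank y (j ∸ s))
      pairs-≲ {s} {i} {j} {x} {y} 1≤s s≤i i<j j≤n x-rank y-rank =
        subst₂ _≲_ (count-pairs (subst (_< j) (sym x-rank) i<j))
                   (count-pairs (subst (_< j ∸ s) (sym y-rank) (∸-monoˡ-< i<j s≤i)))
                   (step-iterate s 1≤s s≤i i<j j≤n x-rank y-rank)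

    module _ (descending : Descending P) where

      count-shift-≤ : ∀ {J i s x y} k → AllPairs _<_ J → All (λ j → i < j × j ≤ n) J → 1 ≤ s → s ≤ i →
        rank P x ≡ i → rank P y ≡ i ∸ s → count (suc k) x (shifted J 0) ≤ count (suc k) y (shifted J s)
      count-shift-≤ {J} {s = s} {x} {y} zero _ _ _ _ _ _ =
        ≤-reflexive (trans (count-one x (shifted J 0)) (sym (count-one y (shifted J s))))
      count-shift-≤ {x = x} (suc k) [] [] _ _ _ _ =
        subst (_≤ _) (sym (count-vacuous x (shifted [] 0) (s≤s (s≤s z≤n)) λ _ ())) z≤n
      count-shift-≤ {j ∷ J} {i} {s} {x} {y} (suc k) (j<J ∷ sorted) ((i<j , j≤n) ∷ bounds) 1≤s s≤i x-rank y-rank =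
        begin
          count (suc (suc k)) x (shifted (j ∷ J) 0)
            ≡⟨ count-decompose-head (suc k) j<J z≤n (subst (_< j) (sym x-rank) i<j) ⟩
          count (suc (suc k)) x (shifted J 0) + ∑ (aboveAtRank x j) (λ z → count (suc k) z (shifted J 0))
            ≤⟨ +-mono-≤ (count-shift-≤ (suc k) sorted bounds 1≤s s≤i x-rank y-rank)
                        (∑-≤-∑ (pairs-≲ _≤_ ≤-trans descending 1≤s s≤i i<j j≤n x-rank y-rank) λ z∈ w∈ →
                           count-shift-≤ k sorted (raise-lower-bound j<J bounds) 1≤s (≤-trans s≤i (<⇒≤ i<j))
                                         (proj₂ (∈-aboveAtRank⁻ z∈)) (proj₂ (∈-aboveAtRank⁻ w∈))) ⟩
          count (suc (suc k)) y (shifted J s) + ∑ (aboveAtRank y (j ∸ s)) (λ w → count (suc k) w (shifted J s))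
            ≡⟨ count-decompose-head (suc k) j<J (≤-trans s≤i (<⇒≤ i<j))
                                    (subst (_< j ∸ s) (sym y-rank) (∸-monoˡ-< i<j s≤i)) ⟨
          count (suc (suc k)) y (shifted (j ∷ J) s) ∎
        where open ≤-Reasoning

      count-shift-< : StrictlyDescending P → ∀ {J i s x y} k → suc k ≤ length J → AllPairs _<_ J →
        All (λ j → i < j × j ≤ n) J → 1 ≤ s → s ≤ i → rank P x ≡ i → rank P y ≡ i ∸ s →
        count (suc (suc k)) x (shifted J 0) < count (suc (suc k)) y (shifted J s)
      count-shift-< strictly-descending {j ∷ J} {i} {s} {x} {y} k (s≤s k≤|J|) (j<J ∷ sorted) ((i<j , j≤n) ∷ bounds)
                    1≤s s≤i x-rank y-rank =
        begin-strict
          count (suc (suc k)) x (shifted (j ∷ J) 0)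
            ≡⟨ count-decompose-head (suc k) j<J z≤n (subst (_< j) (sym x-rank) i<j) ⟩
          count (suc (suc k)) x (shifted J 0) + ∑ (aboveAtRank x j) (λ z → count (suc k) z (shifted J 0))
            <⟨ +-mono-≤-< (count-shift-≤ (suc k) sorted bounds 1≤s s≤i x-rank y-rank)
                          (∑-<-∑ (pairs-≲ _<_ <-trans strictly-descending 1≤s s≤i i<j j≤n x-rank y-rank)
                                 (λ z∈ w∈ → count-shift-≤ k sorted bounds′ 1≤s s≤j
                                              (proj₂ (∈-aboveAtRank⁻ z∈)) (proj₂ (∈-aboveAtRank⁻ w∈)))
                                 (positive k k≤|J| ∘ proj₂ ∘ ∈-aboveAtRank⁻)) ⟩
          count (suc (suc k)) y (shifted J s) + ∑ (aboveAtRank y (j ∸ s)) (λ w → count (suc k) w (shifted J s))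
            ≡⟨ count-decompose-head (suc k) j<J s≤j (subst (_< j ∸ s) (sym y-rank) (∸-monoˡ-< i<j s≤i)) ⟨
          count (suc (suc k)) y (shifted (j ∷ J) s) ∎
        where
          open ≤-Reasoning
          s≤j = ≤-trans s≤i (<⇒≤ i<j)
          bounds′ = raise-lower-bound j<J bounds
          positive : ∀ k → k ≤ length J → ∀ {w} → rank P w ≡ j ∸ s → 0 < count (suc k) w (shifted J s)
          positive zero    _     {w} _      = subst (0 <_) (sym (count-one w (shifted J s))) z<s
          positive (suc k) k<|J|     w-rank =
            let z , z-rank = rank-surjective height≡ j≤n in
            ≤-<-trans z≤n (count-shift-< strictly-descending k k<|J| sorted bounds′ 1≤s s≤j z-rank w-rank)

fact5p2 : (P : FinPoset) (n : ℕ) → height P ≡ suc n → Homogeneous P → Descending P →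
    ∀ (k i s : ℕ) (J : List ℕ) → 2 ≤ k → 1 ≤ i → i ≤ n → 1 ≤ s → s ≤ i →
    Unique J → All (λ j → i < j × j ≤ n) J →
    ∀ (x y : Elt P) → rank P x ≡ i → rank P y ≡ i ∸ s →
    (c′ P k ⁅ x ⁆ J ≤ c′ P k ⁅ y ⁆ (map (λ j → j ∸ s) J))
    × (StrictlyDescending P → k ≤ suc (length J) → c′ P k ⁅ x ⁆ J < c′ P k ⁅ y ⁆ (map (λ j → j ∸ s) J))
fact5p2 P n height≡ _ descending (suc (suc k)) i s J (s≤s (s≤s z≤n)) _ _ 1≤s s≤i unique bounds x y x-rank y-rank =
  subst₂ _≤_ (sym x-side) (sym y-side) (count-shift-≤ P height≡ descending (suc k) sorted bounds′ 1≤s s≤i x-rank y-rank) ,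
  λ strictly-descending k+2≤ → subst₂ _<_ (sym x-side) (sym y-side)
    (count-shift-< P height≡ descending strictly-descending k (subst (suc k ≤_) (sym (↭-length J̃↭J)) (≤-pred k+2≤))
                   sorted bounds′ 1≤s s≤i x-rank y-rank)
  where
    J̃ = proj₁ (unique⇒↭-strictlySorted unique)
    sorted = proj₁ (proj₂ (unique⇒↭-strictlySorted unique))
    J̃↭J = proj₂ (proj₂ (unique⇒↭-strictlySorted unique))
    bounds′ = All-resp-↭ (↭-sym J̃↭J) bounds
    x-side : c′ P (suc (suc k)) ⁅ x ⁆ J ≡ count P (suc (suc k)) x (shifted P J̃ 0)
    x-side = count-cong P _ x λ r → inJ-≡ P J J̃ {r} {r + 0} (⇔-trans (↭⇒∈-⇔ (↭-sym J̃↭J))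
               (mk⇔ (subst (_∈ J̃) (sym (+-identityʳ r))) (subst (_∈ J̃) (+-identityʳ r))))
    y-side : c′ P (suc (suc k)) ⁅ y ⁆ (map (λ j → j ∸ s) J) ≡ count P (suc (suc k)) y (shifted P J̃ s)
    y-side = count-cong P _ y λ r → inJ-≡ P (map (λ j → j ∸ s) J) J̃ {r} {r + s}
               (⇔-trans (∈-map-∸ {s} {r} (All.map (λ (i<j , _) → ≤-trans s≤i (<⇒≤ i<j)) bounds)) (↭⇒∈-⇔ (↭-sym J̃↭J)))
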